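{- Every complete folding sequence $(a_h)_{h\in\mathbb{Z}}$ is nonperiodic: if $r\in\mathbb{Z}$ satisfies $a_{h+r}=a_h$ for all $h\in\mathbb{Z}$, then $r=0$.
   Context: All sequences take values in $\{+1,-1\}$. For $S=(a_1,\dots,a_n)$ write $\overline{S}=(-a_n,\dots,-a_1)$. The $n$-folding sequences are defined recursively: the only $0$-folding sequence is the empty sequence, and the $(n+1)$-folding sequences are exactly $(\overline{S},+1,S)$ and $(\overline{S},-1,S)$ with $S$ an $n$-folding sequence. A finite sequence $(u_1,\dots,u_m)$ is a subword of a sequence $(b_k)$ if there is $h$ with $u_k=b_{k+h}$ for $1\le k\le m$. A complete folding sequence is a sequence $(a_k)_{k\in\mathbb{Z}}$ each finite subword of which is a subword of some $n$-folding sequence. -}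

module Defs where

open import Data.Nat using (ℕ; zero; suc)
open import Data.Integer using (ℤ; _+_; +_)
open import Data.Sign using (Sign; opposite) renaming (+ to pos; - to neg)
open import Data.List using (List; []; _∷_; _++_; reverse; map)
open import Data.Product using (∃; ∃₂; _×_)
open import Relation.Binary.PropositionalEquality using (_≡_)

-- values in {+1,-1} are represented by Data.Sign.Sign

bar : List Sign → List Sign
bar S = reverse (map opposite S)

data Folding : ℕ → List Sign → Set where
  fold0 : Folding zero []
  foldS : ∀ {n S} (s : Sign) → Folding n S → Folding (suc n) (bar S ++ (s ∷ S))

SubwordOf : List Sign → List Sign → Set
SubwordOf u b = ∃₂ λ xs ys → xs ++ (u ++ ys) ≡ b

window : (ℤ → Sign) → ℤ → ℕ → List Sign
window a h zero = []
window a h (suc m) = a (h + + 1) ∷ window a (h + + 1) m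

-- every finite subword (= every window) is a subword of some n-folding sequence
CompleteFolding : (ℤ → Sign) → Set
CompleteFolding a = ∀ (h : ℤ) (m : ℕ) →
  ∃₂ λ (n : ℕ) (S : List Sign) → Folding n S × SubwordOf (window a h m) S

module Submission where

-- An (n+1)-folding sequence S interleaves an n-folding sequence T with
-- alternating signs:  S = (c, t₁, -c, t₂, c, …).  Suppose a word of length 4P
-- sitting inside a folding sequence had period P > 0.  Its entries at the even
-- positions of S alternate in sign, and shifting them by 2P (two periods) flips
-- the sign P times, so P must be even, P = 2Q.  Its entries at the odd positions
-- of S form a word of length 4Q inside T with period Q.  Descending through the
-- levels, the length 4P ≤ 2ⁿ of the word eventually exceeds the length of the
-- folding sequence, which is impossible.
--
-- A ℤ-indexed periodic sequence would
-- contain such a periodic word among its windows, which gives the theorem.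
-- (FoldingWords is a separate module so that its _+_ is addition on ℕ; the last
-- part of the file uses the integer addition of the statement.)

open import Defs
open import Data.Nat using (ℕ; zero; suc; _*_; _<_; z≤n; s≤s)
open import Data.Nat.Properties using (≤-reflexive)
open import Data.Sign using (Sign; opposite) renaming (+ to pos; - to neg)
open import Data.Sign.Properties using (opposite-involutive)
open import Data.List using (List; []; _∷_; _++_; reverse; map; length)
import Data.List.Properties as LP
open import Data.Product using (∃; ∃₂; _×_; _,_)
open import Data.Unit using (⊤; tt)
open import Data.Empty using (⊥-elim)
open import Relation.Nullary using (¬_)
open import Relation.Binary.PropositionalEquality
  using (_≡_; refl; sym; trans; cong; subst; module ≡-Reasoning)

module FoldingWords where
  open import Data.Nat using (_+_; _^_; _≤_)
  import Data.Nat.Properties as ℕP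
  open import Data.Nat.Tactic.RingSolver using (solve-∀)
  open ≡-Reasoning

  inter : Sign → List Sign → List Sign
  inter c []      = c ∷ []
  inter c (t ∷ T) = c ∷ t ∷ inter (opposite c) T

  nextSign : Sign → List Sign → Sign
  nextSign c []      = opposite c
  nextSign c (_ ∷ T) = nextSign (opposite c) T

  inter-++ : ∀ c U x V → inter c U ++ x ∷ inter (nextSign c U) V ≡ inter c (U ++ x ∷ V)
  inter-++ c []      x V = refl
  inter-++ c (u ∷ U) x V = cong (λ W → c ∷ u ∷ W) (inter-++ (opposite c) U x V)

  nextSign-∷ʳ : ∀ c U x → nextSign c (U ++ x ∷ []) ≡ opposite (nextSign c U)
  nextSign-∷ʳ c []      x = refl
  nextSign-∷ʳ c (u ∷ U) x = nextSign-∷ʳ (opposite c) U x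

  bar-++ : ∀ X Y → bar (X ++ Y) ≡ bar Y ++ bar X
  bar-++ X Y = begin
    reverse (map opposite (X ++ Y))            ≡⟨ cong reverse (LP.map-++ opposite X Y) ⟩
    reverse (map opposite X ++ map opposite Y) ≡⟨ LP.reverse-++ (map opposite X) (map opposite Y) ⟩
    bar Y ++ bar X                             ∎

  length-bar : ∀ S → length (bar S) ≡ length S
  length-bar S = trans (LP.length-reverse (map opposite S)) (LP.length-map opposite S)

  bar-inter : ∀ c T → ∃ λ d → bar (inter c T) ≡ inter d (bar T) × nextSign d (bar T) ≡ c
  bar-inter c [] = opposite c , refl , opposite-involutive c
  bar-inter c (t ∷ T) with bar-inter (opposite c) T
  ... | d , bar-eq , next-eq = d , shape , next
    where
    shape : bar (inter c (t ∷ T)) ≡ inter d (bar (t ∷ T))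
    shape = begin
      bar ((c ∷ t ∷ []) ++ inter (opposite c) T)
        ≡⟨ bar-++ (c ∷ t ∷ []) (inter (opposite c) T) ⟩
      bar (inter (opposite c) T) ++ opposite t ∷ opposite c ∷ []
        ≡⟨ cong (_++ opposite t ∷ opposite c ∷ []) bar-eq ⟩
      inter d (bar T) ++ opposite t ∷ inter (opposite c) []
        ≡⟨ cong (λ e → inter d (bar T) ++ opposite t ∷ inter e []) (sym next-eq) ⟩
      inter d (bar T) ++ opposite t ∷ inter (nextSign d (bar T)) []
        ≡⟨ inter-++ d (bar T) (opposite t) [] ⟩
      inter d (bar T ++ opposite t ∷ [])
        ≡⟨ cong (inter d) (sym (bar-++ (t ∷ []) T)) ⟩
      inter d (bar (t ∷ T)) ∎
    next : nextSign d (bar (t ∷ T)) ≡ c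
    next = begin
      nextSign d (bar ((t ∷ []) ++ T))      ≡⟨ cong (nextSign d) (bar-++ (t ∷ []) T) ⟩
      nextSign d (bar T ++ opposite t ∷ []) ≡⟨ nextSign-∷ʳ d (bar T) (opposite t) ⟩
      opposite (nextSign d (bar T))         ≡⟨ cong opposite next-eq ⟩
      opposite (opposite c)                 ≡⟨ opposite-involutive c ⟩
      c                                     ∎

  folding-inter : ∀ {n S} → Folding (suc n) S → ∃₂ λ c T → Folding n T × S ≡ inter c T
  folding-inter (foldS s fold0) = s , [] , fold0 , refl
  folding-inter (foldS {S = S} s F@(foldS _ _)) with folding-inter F
  ... | c , T , FT , S≡ with bar-inter c T
  ... | d , bar-eq , next-eq = d , bar T ++ s ∷ T , foldS s FT , shape
    where
    shape : bar S ++ s ∷ S ≡ inter d (bar T ++ s ∷ T)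
    shape = begin
      bar S ++ s ∷ S
        ≡⟨ cong (λ X → bar X ++ s ∷ X) S≡ ⟩
      bar (inter c T) ++ s ∷ inter c T
        ≡⟨ cong (λ X → X ++ s ∷ inter c T) bar-eq ⟩
      inter d (bar T) ++ s ∷ inter c T
        ≡⟨ cong (λ e → inter d (bar T) ++ s ∷ inter e T) (sym next-eq) ⟩
      inter d (bar T) ++ s ∷ inter (nextSign d (bar T)) T
        ≡⟨ inter-++ d (bar T) s T ⟩
      inter d (bar T ++ s ∷ T) ∎

  length-folding : ∀ {n S} → Folding n S → suc (length S) ≡ 2 ^ n
  length-folding fold0 = refl
  length-folding (foldS {n} {S} s F) = begin
    suc (length (bar S ++ s ∷ S))         ≡⟨ cong suc (LP.length-++ (bar S)) ⟩
    suc (length (bar S) + suc (length S)) ≡⟨ cong (λ l → suc (l + suc (length S))) (length-bar S) ⟩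
    suc (length S + suc (length S))       ≡⟨ twice (length S) ⟩
    2 * suc (length S)                    ≡⟨ cong (2 *_) (length-folding F) ⟩
    2 * 2 ^ n                             ∎
    where
    twice : ∀ l → suc (l + suc l) ≡ 2 * suc l
    twice = solve-∀

  flips : ℕ → Sign → Sign
  flips zero    c = c
  flips (suc j) c = flips j (opposite c)

  flips-+ : ∀ j k c → flips (j + k) c ≡ flips k (flips j c)
  flips-+ zero    k c = refl
  flips-+ (suc j) k c = flips-+ j k (opposite c)

  flips-fixed⇒even : ∀ k c → flips k c ≡ c → ∃ λ q → k ≡ 2 * q
  flips-fixed⇒even zero          c   _  = 0 , refl
  flips-fixed⇒even (suc zero)    pos ()
  flips-fixed⇒even (suc zero)    neg ()
  flips-fixed⇒even (suc (suc k)) c   eq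
    with flips-fixed⇒even k c (trans (cong (flips k) (sym (opposite-involutive c))) eq)
  ... | q , refl = suc q , sym (ℕP.*-suc 2 q)

  even-above : ∀ k → ∃₂ λ r j → r ≤ 1 × k + r ≡ 2 * j
  odd-above  : ∀ k → ∃₂ λ r j → r ≤ 1 × k + r ≡ suc (2 * j)
  even-above zero = 0 , 0 , z≤n , refl
  even-above (suc k) with odd-above k
  ... | r , j , r≤1 , eq = r , suc j , r≤1 , trans (cong suc eq) (sym (ℕP.*-suc 2 j))
  odd-above zero = 1 , 0 , s≤s z≤n , refl
  odd-above (suc k) with even-above k
  ... | r , j , r≤1 , eq = r , j , r≤1 , cong suc eq

  _isPrefixOf_ : List Sign → (ℕ → Sign) → Set
  []      isPrefixOf f = ⊤
  (x ∷ S) isPrefixOf f = x ≡ f zero × S isPrefixOf (λ i → f (suc i))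

  isPrefixOf-++ : ∀ xs W ys f → (xs ++ W ++ ys) isPrefixOf f → W isPrefixOf (λ i → f (length xs + i))
  isPrefixOf-++ [] [] ys f _ = tt
  isPrefixOf-++ [] (w ∷ W) ys f (w≡ , W⊑) = w≡ , isPrefixOf-++ [] W ys (λ i → f (suc i)) W⊑
  isPrefixOf-++ (x ∷ xs) W ys f (_ , ⊑) = isPrefixOf-++ xs W ys (λ i → f (suc i)) ⊑

  isPrefixOf-agree : ∀ W f g → W isPrefixOf f → W isPrefixOf g → ∀ i → i < length W → f i ≡ g i
  isPrefixOf-agree (w ∷ W) f g (w≡f , _) (w≡g , _) zero _ = trans (sym w≡f) w≡g
  isPrefixOf-agree (w ∷ W) f g (_ , W⊑f) (_ , W⊑g) (suc i) (s≤s i<) =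
    isPrefixOf-agree W (λ j → f (suc j)) (λ j → g (suc j)) W⊑f W⊑g i i<

  interleave : Sign → (ℕ → Sign) → ℕ → Sign
  interleave c g zero          = c
  interleave c g (suc zero)    = g zero
  interleave c g (suc (suc i)) = interleave (opposite c) (λ j → g (suc j)) i

  interleave-even : ∀ c g j → interleave c g (2 * j) ≡ flips j c
  interleave-even c g zero    = refl
  interleave-even c g (suc j) =
    trans (cong (interleave c g) (ℕP.*-suc 2 j)) (interleave-even (opposite c) (λ i → g (suc i)) j)

  interleave-odd : ∀ c g j → interleave c g (suc (2 * j)) ≡ g j
  interleave-odd c g zero    = refl
  interleave-odd c g (suc j) =
    trans (cong (λ i → interleave c g (suc i)) (ℕP.*-suc 2 j)) (interleave-odd (opposite c) (λ i → g (suc i)) j)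

  inter-isPrefixOf : ∀ c g T → T isPrefixOf g → inter c T isPrefixOf interleave c g
  inter-isPrefixOf c g []      _          = refl , tt
  inter-isPrefixOf c g (t ∷ T) (t≡ , T⊑) = refl , t≡ , inter-isPrefixOf (opposite c) (λ j → g (suc j)) T T⊑

  -- n-folding functions, the infinite counterpart of n-folding sequences: at level
  -- n+1 the even positions alternate in sign and the odd positions form an
  -- n-folding function; level 0 is unconstrained
  FoldingFn : ℕ → (ℕ → Sign) → Set
  FoldingFn zero    f = ⊤
  FoldingFn (suc n) f = ∃₂ λ c g → FoldingFn n g ×
    (∀ j → f (2 * j) ≡ flips j c) × (∀ j → f (suc (2 * j)) ≡ g j)

  folding-isPrefixOf : ∀ n {S} → Folding n S → ∃ λ f → FoldingFn n f × S isPrefixOf f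
  folding-isPrefixOf zero    fold0 = (λ _ → pos) , tt , tt
  folding-isPrefixOf (suc n) F with folding-inter F
  ... | c , T , FT , S≡ with folding-isPrefixOf n FT
  ... | g , g-folding , T⊑g =
    interleave c g ,
    (c , g , g-folding , interleave-even c g , interleave-odd c g) ,
    subst (_isPrefixOf interleave c g) (sym S≡) (inter-isPrefixOf c g T T⊑g)

  PeriodicOn : (ℕ → Sign) → (k P L : ℕ) → Set
  PeriodicOn f k P L = ∀ i → i + P < L → f (k + i + P) ≡ f (k + i)

  -- a window whose even positions alternate in sign has only even periods:
  -- comparing an even position 2j with 2j + 2P flips its sign P times
  alternating⇒period-even : ∀ {f c k P L} → (∀ j → f (2 * j) ≡ flips j c) →
    PeriodicOn f k P L → 1 + 2 * P < L → ∃ λ q → P ≡ 2 * q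
  alternating⇒period-even {f} {c} {k} {P} {L} even per long with even-above k
  ... | r , j , r≤1 , k+r≡ = flips-fixed⇒even P (flips j c) fixed
    where
    regroup : ∀ k r P → k + r + 2 * P ≡ k + (r + P) + P
    regroup = solve-∀
    double : ∀ r P → r + P + P ≡ r + 2 * P
    double = solve-∀
    position : 2 * (j + P) ≡ k + (r + P) + P
    position = begin
      2 * (j + P)       ≡⟨ ℕP.*-distribˡ-+ 2 j P ⟩
      2 * j + 2 * P     ≡⟨ cong (_+ 2 * P) (sym k+r≡) ⟩
      k + r + 2 * P     ≡⟨ regroup k r P ⟩
      k + (r + P) + P   ∎
    two-shifts-inside : r + P + P < L
    two-shifts-inside = ℕP.≤-<-trans (ℕP.≤-trans (≤-reflexive (double r P)) (ℕP.+-monoˡ-≤ (2 * P) r≤1)) long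
    one-shift-inside : r + P < L
    one-shift-inside = ℕP.≤-<-trans (ℕP.m≤m+n (r + P) P) two-shifts-inside
    fixed : flips P (flips j c) ≡ flips j c
    fixed = begin
      flips P (flips j c)  ≡⟨ sym (flips-+ j P c) ⟩
      flips (j + P) c      ≡⟨ sym (even (j + P)) ⟩
      f (2 * (j + P))      ≡⟨ cong f position ⟩
      f (k + (r + P) + P)  ≡⟨ per (r + P) two-shifts-inside ⟩
      f (k + (r + P))      ≡⟨ cong f (sym (ℕP.+-assoc k r P)) ⟩
      f (k + r + P)        ≡⟨ per r one-shift-inside ⟩
      f (k + r)            ≡⟨ cong f k+r≡ ⟩
      f (2 * j)            ≡⟨ even j ⟩
      flips j c            ∎

  odd-positions-periodic : ∀ {f g k Q L} → (∀ j → f (suc (2 * j)) ≡ g j) →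
    PeriodicOn f k (2 * Q) (2 * L) → ∃ λ k′ → PeriodicOn g k′ Q L
  odd-positions-periodic {f} {g} {k} {Q} {L} odd per with odd-above k
  ... | s , k′ , s≤1 , k+s≡ = k′ , periodic
    where
    merge : ∀ a b → suc (2 * a) + 2 * b ≡ suc (2 * (a + b))
    merge = solve-∀
    split : ∀ a b c → suc (2 * (a + b + c)) ≡ suc (2 * (a + b)) + 2 * c
    split = solve-∀
    double-suc : ∀ a b → 2 + 2 * a + 2 * b ≡ 2 * suc (a + b)
    double-suc = solve-∀
    position : ∀ i → k + (s + 2 * i) ≡ suc (2 * (k′ + i))
    position i = begin
      k + (s + 2 * i)      ≡⟨ sym (ℕP.+-assoc k s (2 * i)) ⟩
      k + s + 2 * i        ≡⟨ cong (_+ 2 * i) k+s≡ ⟩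
      suc (2 * k′) + 2 * i ≡⟨ merge k′ i ⟩
      suc (2 * (k′ + i))   ∎
    shifted : ∀ i → suc (2 * (k′ + i + Q)) ≡ k + (s + 2 * i) + 2 * Q
    shifted i = trans (split k′ i Q) (cong (_+ 2 * Q) (sym (position i)))
    inside : ∀ i → i + Q < L → s + 2 * i + 2 * Q < 2 * L
    inside i i+Q<L = ℕP.≤-trans
      (s≤s (ℕP.+-monoˡ-≤ (2 * Q) (ℕP.+-monoˡ-≤ (2 * i) s≤1)))
      (ℕP.≤-trans (≤-reflexive (double-suc i Q)) (ℕP.*-monoʳ-≤ 2 i+Q<L))
    periodic : PeriodicOn g k′ Q L
    periodic i i+Q<L = begin
      g (k′ + i + Q)                ≡⟨ sym (odd (k′ + i + Q)) ⟩
      f (suc (2 * (k′ + i + Q)))    ≡⟨ cong f (shifted i) ⟩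
      f (k + (s + 2 * i) + 2 * Q)   ≡⟨ per (s + 2 * i) (inside i i+Q<L) ⟩
      f (k + (s + 2 * i))           ≡⟨ cong f (position i) ⟩
      f (suc (2 * (k′ + i)))        ≡⟨ odd (k′ + i) ⟩
      g (k′ + i)                    ∎

  -- room for the two shifts used in alternating⇒period-even inside a window of length 4P
  room-for-two-periods : ∀ P → 0 < P → 1 + 2 * P < 4 * P
  room-for-two-periods P 0<P =
    ℕP.≤-trans (ℕP.+-monoˡ-≤ (2 * P) (ℕP.*-monoʳ-≤ 2 0<P)) (≤-reflexive (double-double P))
    where
    double-double : ∀ P → 2 * P + 2 * P ≡ 4 * P
    double-double = solve-∀

  -- a window of length 4 · 2Q is a window of length 2 · 4Q, as needed to halve it
  four-double : ∀ Q → 4 * (2 * Q) ≡ 2 * (4 * Q)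
  four-double = solve-∀

  -- an n-folding function has no window of length 4P ≤ 2ⁿ with period P > 0:
  -- the period is even, and halving it descends to the (n-1)-folding function
  -- along the odd positions, until the bound 4P ≤ 2⁰ fails
  no-period : ∀ n {f} → FoldingFn n f → ∀ k P → 0 < P → 4 * P ≤ 2 ^ n → ¬ PeriodicOn f k P (4 * P)
  no-period zero _ k P 0<P 4P≤1 _ with ℕP.≤-trans (ℕP.*-monoʳ-≤ 4 0<P) 4P≤1
  ... | s≤s ()
  no-period (suc n) {f} (c , g , g-folding , even , odd) k P 0<P 4P≤2ⁿ⁺¹ per
    with alternating⇒period-even {f} even per (room-for-two-periods P 0<P)
  ... | Q , refl with odd-positions-periodic {f} odd (subst (PeriodicOn f k (2 * Q)) (four-double Q) per)
  ... | k′ , per′ = no-period n g-folding k′ Q (half-positive Q 0<P) shorter per′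
    where
    half-positive : ∀ Q → 0 < 2 * Q → 0 < Q
    half-positive (suc Q) _ = s≤s z≤n
    shorter : 4 * Q ≤ 2 ^ n
    shorter = ℕP.*-cancelˡ-≤ 2 (subst (_≤ 2 * 2 ^ n) (four-double Q) 4P≤2ⁿ⁺¹)

  subword-length : ∀ {W S} → SubwordOf W S → length W ≤ length S
  subword-length {W} (xs , ys , refl) =
    ℕP.≤-trans (ℕP.m≤m+n (length W) (length ys))
      (ℕP.≤-trans (ℕP.m≤n+m _ (length xs)) (≤-reflexive (sym length-split)))
    where
    length-split : length (xs ++ W ++ ys) ≡ length xs + (length W + length ys)
    length-split = trans (LP.length-++ xs) (cong (length xs +_) (LP.length-++ W))

  folding-subword-aperiodic : ∀ {n S W} (b : ℕ → Sign) P → Folding n S → SubwordOf W S →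
    W isPrefixOf b → 0 < P → 4 * P ≤ length W → ¬ PeriodicOn b 0 P (4 * P)
  folding-subword-aperiodic {n} {S} {W} b P F sub@(xs , ys , S≡) W⊑b 0<P long per
    with folding-isPrefixOf n F
  ... | f , f-folding , S⊑f = no-period n f-folding (length xs) P 0<P short per-f
    where
    k = length xs
    W⊑f : W isPrefixOf (λ i → f (k + i))
    W⊑f = isPrefixOf-++ xs W ys f (subst (_isPrefixOf f) (sym S≡) S⊑f)
    agree : ∀ i → i < 4 * P → f (k + i) ≡ b i
    agree i i< = isPrefixOf-agree W (λ j → f (k + j)) b W⊑f W⊑b i (ℕP.<-≤-trans i< long)
    short : 4 * P ≤ 2 ^ n
    short = ℕP.≤-trans long (ℕP.≤-trans (subword-length sub)
              (ℕP.≤-trans (ℕP.n≤1+n (length S)) (≤-reflexive (length-folding F))))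
    per-f : PeriodicOn f k P (4 * P)
    per-f i i+P< = begin
      f (k + i + P)   ≡⟨ cong f (ℕP.+-assoc k i P) ⟩
      f (k + (i + P)) ≡⟨ agree (i + P) i+P< ⟩
      b (i + P)       ≡⟨ per i i+P< ⟩
      b i             ≡⟨ sym (agree i (ℕP.≤-<-trans (ℕP.m≤m+n i P) i+P<)) ⟩
      f (k + i)       ∎

open FoldingWords using (_isPrefixOf_; folding-subword-aperiodic)
open import Data.Integer using (ℤ; _+_; +_; -_; -[1+_])
open import Data.Integer.Properties using (+-assoc; +-inverseˡ; +-identityʳ)
open ≡-Reasoning

window-isPrefixOf : ∀ a h m f → (∀ i → f i ≡ a (h + + suc i)) → window a h m isPrefixOf f
window-isPrefixOf a h zero    f f≡ = tt
window-isPrefixOf a h (suc m) f f≡ =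
  sym (f≡ 0) , window-isPrefixOf a (h + + 1) m (λ i → f (suc i))
                 (λ i → trans (f≡ (suc i)) (cong a (sym (+-assoc h (+ 1) (+ suc i)))))

length-window : ∀ a h m → length (window a h m) ≡ m
length-window a h zero    = refl
length-window a h (suc m) = cong suc (length-window a (h + + 1) m)

period-neg : ∀ (a : ℤ → Sign) r → (∀ h → a (h + r) ≡ a h) → ∀ h → a (h + - r) ≡ a h
period-neg a r per h = begin
  a (h + - r)           ≡⟨ sym (per (h + - r)) ⟩
  a (h + - r + r)       ≡⟨ cong a (+-assoc h (- r) r) ⟩
  a (h + (- r + r))     ≡⟨ cong (λ z → a (h + z)) (+-inverseˡ r) ⟩
  a (h + + 0)           ≡⟨ cong a (+-identityʳ h) ⟩
  a h                   ∎

-- a complete folding sequence has no positive period P: its window of length 4P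
-- after position 0 would be a periodic word inside a folding sequence
no-positive-period : ∀ a → CompleteFolding a → ∀ P → 0 < P → ¬ (∀ h → a (h + + P) ≡ a h)
no-positive-period a complete P 0<P per with complete (+ 0) (4 * P)
... | n , S , F , sub =
  folding-subword-aperiodic (λ i → a (+ suc i)) P F sub
    (window-isPrefixOf a (+ 0) (4 * P) (λ i → a (+ suc i)) (λ i → refl)) 0<P
    (≤-reflexive (sym (length-window a (+ 0) (4 * P))))
    (λ i _ → per (+ suc i))

corollary1p3 : (a : ℤ → Sign) → CompleteFolding a →
    (r : ℤ) → (∀ h → a (h + r) ≡ a h) → r ≡ + 0
corollary1p3 a complete (+ zero)   per = refl
corollary1p3 a complete (+ suc p)  per = ⊥-elim (no-positive-period a complete (suc p) (s≤s z≤n) per)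
corollary1p3 a complete -[1+ p ]   per =
  ⊥-elim (no-positive-period a complete (suc p) (s≤s z≤n) (period-neg a -[1+ p ] per))
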